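{- Let $\mathcal A,\mathcal B$ be countably infinite structures, let $(\Phi,\Phi_*)$ witness a computable functor $F:\mathrm{Iso}(\mathcal B)\to\mathrm{Iso}(\mathcal A)$, and let $\mathrm{Dom}^{\mathcal B}_{\mathcal A}$ and $\sim$ be as defined below. Then $\sim$ is an equivalence relation on $\mathrm{Dom}^{\mathcal B}_{\mathcal A}$.
   Context: $\mathrm{Iso}(\mathcal A)$ is the category of copies of $\mathcal A$ with domain $\omega$ and all isomorphisms; $D(\mathcal M)$ is the atomic diagram. A computable functor $F:\mathrm{Iso}(\mathcal B)\to\mathrm{Iso}(\mathcal A)$ is given by computable operators $\Phi,\Phi_*$ with $\Phi^{D(\hat{\mathcal B})}=D(F(\hat{\mathcal B}))$ and $\Phi_*^{D(\hat{\mathcal B})\oplus f\oplus D(\tilde{\mathcal B})}=F(f)$ for isomorphisms $f:\hat{\mathcal B}\to\tilde{\mathcal B}$ (functions identified with graphs); $F$ preserves identities and composition. Notation: $\lambda$ is the identity on $\omega$. For a tuple $\bar b$ of length $n$, $D(\bar b)$ is the finite binary string coding (fixed Gödel numbering) the atomic facts about $(0,\dots,n-1)$ in the pullback $\mathcal B_f$ (for any bijection $f:\omega\to\mathcal B$ extending $k\mapsto b_k$) mentioning only the first $n$ relation symbols; it is an initial segment of $D(\mathcal B_f)$. For a permutation $\sigma$ of $\{0,\dots,m-1\}$, $(\bar x)_\sigma=(x_{\sigma(0)},\dots,x_{\sigma(m-1)})$. A finite-oracle computation converges if it halts without querying beyond the oracle. $\mathrm{Dom}^{\mathcal B}_{\mathcal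 A}$ is the set of $(\bar b,i)\in\mathcal B^{<\omega}\times\omega$ with $\Phi_*^{D(\bar b)\oplus\lambda\upharpoonright|\bar b|\oplus D(\bar b)}(i)\downarrow=i$. For $(\bar b,i),(\bar c,j)\in\mathrm{Dom}^{\mathcal B}_{\mathcal A}$: $(\bar b,i)\sim(\bar c,j)$ iff there is a finite tuple $\bar d$ not mentioning elements of $\bar b,\bar c$ such that, letting $\bar c'$ list $\bar c\setminus\bar b$, $\bar b'$ list $\bar b\setminus\bar c$, and $\sigma$ be the finite permutation with $(\bar b\bar c'\bar d)=(\bar c\bar b'\bar d)_\sigma$, we have $\Phi_*^{D(\bar b\bar c'\bar d)\oplus\sigma\oplus D(\bar c\bar b'\bar d)}(i)\downarrow=j$ and $\Phi_*^{D(\bar c\bar b'\bar d)\oplus\sigma^{ -1}\oplus D(\bar b\bar c'\bar d)}(j)\downarrow=i$. -}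

module Defs where

open import Data.Nat using (ℕ; zero; suc; _<ᵇ_; _≡ᵇ_)
import Data.Nat as ℕ
open import Data.Bool using (Bool; true; false; if_then_else_; _∧_)
open import Data.Maybe using (Maybe; just; nothing)
import Data.Maybe as Maybe
open import Data.List using (List; []; _∷_; length; _++_; filter)
open import Data.List.Relation.Unary.All using (All)
open import Data.List.Relation.Unary.Unique.Propositional using (Unique)
open import Data.Vec using (Vec; []; _∷_)
import Data.Vec as Vec
open import Data.Product using (Σ; _×_; _,_; proj₁)
open import Data.Sum using (_⊎_; inj₁; inj₂)
open import Relation.Nullary using (¬_; does; yes; no; ¬?)
open import Relation.Binary.PropositionalEquality using (_≡_; refl; cong; trans; sym)
open import Relation.Binary.Definitions using (DecidableEquality)
open import Relation.Binary.Structures using (IsEquivalence)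

record Sig : Set where
  field arity : ℕ → ℕ
open Sig public

Atom : Sig → Set
Atom L = Σ ℕ (λ j → Vec ℕ (arity L j))

-- A structure with domain ω; it *is* its atomic diagram D(M) : Atom L → Bool.
ωStr : Sig → Set
ωStr L = (j : ℕ) → Vec ℕ (arity L j) → Bool

D : ∀ {L} → ωStr L → Atom L → Bool
D M (j , xs) = M j xs

record IsBij {A B : Set} (h : A → B) : Set where
  field
    inv   : B → A
    inv-l : ∀ a → inv (h a) ≡ a
    inv-r : ∀ b → h (inv b) ≡ b

record CStructure (L : Sig) : Set₁ where
  field
    carrier : Set
    rel     : (j : ℕ) → Vec carrier (arity L j) → Bool
    enum    : ℕ → carrier
    enum-bij : IsBij enum
open CStructure public

decEq : ∀ {L} (S : CStructure L) → DecidableEquality (carrier S)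
decEq S a b with IsBij.inv (enum-bij S) a ℕ.≟ IsBij.inv (enum-bij S) b
... | yes p = yes (trans (sym (IsBij.inv-r (enum-bij S) a))
                   (trans (cong (enum S) p) (IsBij.inv-r (enum-bij S) b)))
... | no ¬p = no (λ e → ¬p (cong (IsBij.inv (enum-bij S)) e))

IsIsoTo : ∀ {L} (M : ωStr L) (S : CStructure L) → (ℕ → carrier S) → Set
IsIsoTo {L} M S h = IsBij h × (∀ j (xs : Vec ℕ (arity L j)) → rel S j (Vec.map h xs) ≡ M j xs)

-- copies of S (objects of Iso(S))
IsCopy : ∀ {L} (S : CStructure L) → ωStr L → Set
IsCopy S M = Σ (ℕ → carrier S) (IsIsoTo M S)

Copy : ∀ {L} → CStructure L → Set
Copy S = Σ (ωStr _) (IsCopy S)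

-- isomorphisms between structures with domain ω (morphisms of Iso(S))
IsIsoω : ∀ {L} (M N : ωStr L) → (ℕ → ℕ) → Set
IsIsoω {L} M N f = IsBij f × (∀ j (xs : Vec ℕ (arity L j)) → N j (Vec.map f xs) ≡ M j xs)

record Functor {LB LA} (B : CStructure LB) (A : CStructure LA) : Set where
  field
    obj      : Copy B → ωStr LA
    obj-copy : (X : Copy B) → IsCopy A (obj X)
    mor      : (X Y : Copy B) (f : ℕ → ℕ) → IsIsoω (proj₁ X) (proj₁ Y) f → ℕ → ℕ
    mor-iso  : (X Y : Copy B) (f : ℕ → ℕ) (p : IsIsoω (proj₁ X) (proj₁ Y) f) →
               IsIsoω (obj X) (obj Y) (mor X Y f p)
    mor-id   : (X : Copy B) (p : IsIsoω (proj₁ X) (proj₁ X) (λ n → n)) →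
               ∀ n → mor X X (λ n → n) p n ≡ n
    mor-comp : (X Y Z : Copy B) (f g : ℕ → ℕ)
               (p : IsIsoω (proj₁ X) (proj₁ Y) f) (q : IsIsoω (proj₁ Y) (proj₁ Z) g)
               (r : IsIsoω (proj₁ X) (proj₁ Z) (λ n → g (f n))) →
               ∀ n → mor X Z (λ n → g (f n)) r n ≡ mor Y Z g q (mor X Y f p n)
open Functor public

-- Oracle machines (Turing functionals) as coinductive query trees.

mutual
  record Machine (Q R : Set) : Set where
    coinductive
    field step : Step Q R

  data Step (Q R : Set) : Set where
    halt : R → Step Q R
    ask  : Q → (Bool → Machine Q R) → Step Q R
    wait : Machine Q R → Step Q R
open Machine public

-- Oracles: partial (finite oracles) or total; `nothing` = beyond the oracle.
Oracle : Set → Set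
Oracle Q = Q → Maybe Bool

total : ∀ {Q} → (Q → Bool) → Oracle Q
total X q = just (X q)

-- M ⟨ α ⟩⇓ r : M halts with output r, every query being answered by α
-- (for a finite oracle: converges without querying beyond the oracle).
data _⟨_⟩⇓_ {Q R : Set} (M : Machine Q R) (α : Oracle Q) (r : R) : Set where
  halt⇓ : step M ≡ halt r → M ⟨ α ⟩⇓ r
  ask⇓  : ∀ {q k b} → step M ≡ ask q k → α q ≡ just b → k b ⟨ α ⟩⇓ r → M ⟨ α ⟩⇓ r
  wait⇓ : ∀ {M'} → step M ≡ wait M' → M' ⟨ α ⟩⇓ r → M ⟨ α ⟩⇓ r

-- Oracle queries for  D(B̂) ⊕ f ⊕ D(B̃) : left diagram, graph of f, right diagram
Q3 : Sig → Set
Q3 L = Atom L ⊎ ((ℕ × ℕ) ⊎ Atom L)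

_⊕₃_⊕₃_ : ∀ {L} → Oracle (Atom L) → Oracle (ℕ × ℕ) → Oracle (Atom L) → Oracle (Q3 L)
(α ⊕₃ β ⊕₃ γ) (inj₁ a) = α a
(α ⊕₃ β ⊕₃ γ) (inj₂ (inj₁ p)) = β p
(α ⊕₃ β ⊕₃ γ) (inj₂ (inj₂ a)) = γ a

graph : (ℕ → ℕ) → (ℕ × ℕ) → Bool
graph f (x , y) = f x ≡ᵇ y

record Witnesses {LB LA} (B : CStructure LB) (A : CStructure LA)
                 (Φ : Atom LA → Machine (Atom LB) Bool)
                 (Φ* : ℕ → Machine (Q3 LB) ℕ) (F : Functor B A) : Set where
  field
    Φ-ok  : (X : Copy B) (a : Atom LA) → Φ a ⟨ total (D (proj₁ X)) ⟩⇓ D (obj F X) a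
    Φ*-ok : (X Y : Copy B) (f : ℕ → ℕ) (p : IsIsoω (proj₁ X) (proj₁ Y) f) (n : ℕ) →
            Φ* n ⟨ total (D (proj₁ X)) ⊕₃ total (graph f) ⊕₃ total (D (proj₁ Y)) ⟩⇓ mor F X Y f p n

nth : ∀ {C : Set} → List C → ℕ → Maybe C
nth []       _       = nothing
nth (x ∷ xs) zero    = just x
nth (x ∷ xs) (suc n) = nth xs n

nths : ∀ {C : Set} {k} → List C → Vec ℕ k → Maybe (Vec C k)
nths bs []       = just []
nths bs (x ∷ xs) = Maybe.zipWith _∷_ (nth bs x) (nths bs xs)

-- D(b̄): the atomic facts about 0,…,n-1 (n = |b̄|) in the pullback along k ↦ b_k,
-- for the first n relation symbols; undefined (nothing) elsewhere.
finDiag : ∀ {L} (S : CStructure L) → List (carrier S) → Oracle (Atom L)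
finDiag S bs (j , xs) =
  if j <ᵇ length bs then Maybe.map (rel S j) (nths bs xs) else nothing

idRestr : ℕ → Oracle (ℕ × ℕ)
idRestr n (x , y) = if (x <ᵇ n) ∧ (y <ᵇ n) then just (x ≡ᵇ y) else nothing

module _ {L} (S : CStructure L) where
  open import Data.List.Membership.DecPropositional (decEq S) using (_∈?_; _∉_)

  -- graph of the finite permutation σ with  ū = (v̄)_σ  (ū, v̄ of the same length m):
  -- σ(x) = y  iff  u_x = v_y, for x, y < m; undefined beyond m.
  permGraph : List (carrier S) → List (carrier S) → Oracle (ℕ × ℕ)
  permGraph us vs (x , y) with nth us x | nth vs y
  ... | just a | just b = just (does (decEq S a b))
  ... | _      | _      = nothing

  -- c̄ ∖ b̄, listed in the order inherited from c̄
  minus : List (carrier S) → List (carrier S) → List (carrier S)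
  minus cs bs = filter (λ x → ¬? (x ∈? bs)) cs

  module _ (Φ* : ℕ → Machine (Q3 L) ℕ) where

    InDom : List (carrier S) × ℕ → Set
    InDom (bs , i) =
      Unique bs ×
      (Φ* i ⟨ finDiag S bs ⊕₃ idRestr (length bs) ⊕₃ finDiag S bs ⟩⇓ i)

    Dom : Set
    Dom = Σ (List (carrier S) × ℕ) InDom

    Sim : Dom → Dom → Set
    Sim ((bs , i) , _) ((cs , j) , _) =
      Σ (List (carrier S)) λ ds →
        Unique ds × All (λ d → d ∉ bs × d ∉ cs) ds ×
        (Φ* i ⟨ finDiag S (bs ++ minus cs bs ++ ds)
                ⊕₃ permGraph (bs ++ minus cs bs ++ ds) (cs ++ minus bs cs ++ ds)
                ⊕₃ finDiag S (cs ++ minus bs cs ++ ds) ⟩⇓ j) ×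
        (Φ* j ⟨ finDiag S (cs ++ minus bs cs ++ ds)
                ⊕₃ permGraph (cs ++ minus bs cs ++ ds) (bs ++ minus cs bs ++ ds)
                ⊕₃ finDiag S (bs ++ minus cs bs ++ ds) ⟩⇓ i)

module Submission where

-- Every copy of B used here is a pullback B_G along an enumeration G : ω → B;
-- for enumerations G, H the map H⁻¹ ∘ G : B_G → B_H is an isomorphism, whose
-- image under the functor we call Fσ G H.  Say (b̄ , i) ⊳ (c̄ , j) when
-- Fσ G H i = j for ALL enumerations G, H beginning with b̄, c̄ respectively.
-- The proof shows that ∼ and ⊳ coincide:
--   ∼ ⇒ ⊳ : the finite oracle of ∼ is a sub-oracle of the full oracle of two
--           enumerations beginning with b̄ c̄' d̄ and c̄ b̄' d̄; functoriality, plus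
--           the fact that Fσ G H fixes i when (b̄ , i) ∈ Dom and G, H begin with
--           b̄, moves the value to arbitrary G, H;
--   ⊳ ⇒ ∼ : take enumerations beginning with b̄ c̄' and c̄ b̄' that agree from
--           position |b̄ c̄'| on; by the use principle a finite part d̄ of that
--           common tail suffices for both runs of Φ*.
-- As ⊳ is reflexive and transitive by functoriality and ∼ is symmetric by
-- definition, ∼ is an equivalence.

open import Defs
open import Data.Bool using (Bool; true; false; if_then_else_)
open import Data.Bool.Properties using (T-≡)
open import Data.List using (List; []; _∷_; length; _++_; applyUpTo)
open import Data.List.Membership.Propositional using (_∈_; _∉_)
open import Data.List.Membership.Propositional.Properties
  using (∈-filter⁺; ∈-filter⁻; ∈-++⁺ˡ; ∈-++⁺ʳ; ∈-++⁻; ∈-applyUpTo⁻)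
open import Data.List.Membership.Propositional.Properties.WithK using (unique∧set⇒bag)
open import Data.List.Properties using (++-assoc; length-++; length-applyUpTo)
open import Data.List.Relation.Binary.BagAndSetEquality using (∼bag⇒↭)
open import Data.List.Relation.Binary.Permutation.Propositional.Properties using (↭-length)
open import Data.List.Relation.Unary.All as All using (All)
open import Data.List.Relation.Unary.Any using (here; there)
open import Data.List.Relation.Unary.Unique.Propositional using (Unique; _∷_)
import Data.List.Relation.Unary.Unique.Propositional.Properties as Unique
open import Data.Maybe using (just; nothing)
import Data.Maybe as Maybe
open import Data.Maybe.Properties using (just-injective)
open import Data.Nat using (ℕ; zero; suc; _+_; _≤_; _<_; _⊔_; z≤n; s≤s; _<ᵇ_; _≡ᵇ_)
open import Data.Nat.Properties
open import Data.Product using (Σ; _×_; _,_; proj₁; proj₂; swap)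
open import Data.Sum using (_⊎_; inj₁; inj₂)
import Data.Sum as Sum
open import Data.Vec using (Vec; []; _∷_)
import Data.Vec as Vec
import Data.Vec.Properties as Vec
open import Function.Bundles using (mk⇔; Equivalence)
open import Relation.Binary.PropositionalEquality
open import Relation.Binary.Structures using (IsEquivalence)
open import Relation.Nullary using (¬_; yes; no; does; ¬?; contradiction)
open import Relation.Nullary.Decidable using (does-⇔)

-- Oracle computations: monotonicity, determinism and the use principle.

infix 4 _⊑_
_⊑_ : ∀ {Q : Set} → Oracle Q → Oracle Q → Set
α ⊑ β = ∀ q v → α q ≡ just v → β q ≡ just v

module _ {Q R : Set} where

  ⇓-extend : ∀ {M : Machine Q R} {α β : Oracle Q} {r} → M ⟨ α ⟩⇓ r → α ⊑ β → M ⟨ β ⟩⇓ r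
  ⇓-extend (halt⇓ s)    α⊑β = halt⇓ s
  ⇓-extend (ask⇓ s a d) α⊑β = ask⇓ s (α⊑β _ _ a) (⇓-extend d α⊑β)
  ⇓-extend (wait⇓ s d)  α⊑β = wait⇓ s (⇓-extend d α⊑β)

  ⇓-functional : ∀ {M : Machine Q R} {α : Oracle Q} {r r'} → M ⟨ α ⟩⇓ r → M ⟨ α ⟩⇓ r' → r ≡ r'
  ⇓-functional (halt⇓ s) (halt⇓ s') with trans (sym s) s'
  ... | refl = refl
  ⇓-functional (ask⇓ s a d) (ask⇓ s' a' d') with trans (sym s) s'
  ... | refl with trans (sym a) a'
  ...   | refl = ⇓-functional d d'
  ⇓-functional (wait⇓ s d) (wait⇓ s' d') with trans (sym s) s'
  ... | refl = ⇓-functional d d'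
  ⇓-functional (halt⇓ s)     (ask⇓ s' _ _)  with () ← trans (sym s) s'
  ⇓-functional (halt⇓ s)     (wait⇓ s' _)   with () ← trans (sym s) s'
  ⇓-functional (ask⇓ s _ _)  (halt⇓ s')     with () ← trans (sym s) s'
  ⇓-functional (ask⇓ s _ _)  (wait⇓ s' _)   with () ← trans (sym s) s'
  ⇓-functional (wait⇓ s _)   (halt⇓ s')     with () ← trans (sym s) s'
  ⇓-functional (wait⇓ s _)   (ask⇓ s' _ _)  with () ← trans (sym s) s'

  -- Use principle: a convergent computation asks finitely many queries, so for
  -- any size measure on queries there is a bound N such that the computation
  -- converges to the same output on every oracle agreeing with α up to size N.
  ⇓-use : (size : Q → ℕ) {M : Machine Q R} {α : Oracle Q} {r : R} → M ⟨ α ⟩⇓ r →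
          Σ ℕ λ N → ∀ β → (∀ q → size q ≤ N → β q ≡ α q) → M ⟨ β ⟩⇓ r
  ⇓-use size (halt⇓ s) = 0 , λ β _ → halt⇓ s
  ⇓-use size (ask⇓ {q = q} s a d) with ⇓-use size d
  ... | N , use = size q ⊔ N , λ β agree →
    ask⇓ s (trans (agree q (m≤m⊔n (size q) N)) a)
           (use β (λ q' q'≤N → agree q' (≤-trans q'≤N (m≤n⊔m (size q) N))))
  ⇓-use size (wait⇓ s d) with ⇓-use size d
  ... | N , use = N , λ β agree → wait⇓ s (use β agree)

module _ {C : Set} where

  nth-< : ∀ (u : List C) m {c} → nth u m ≡ just c → m < length u
  nth-< (x ∷ u) zero    e = s≤s z≤n
  nth-< (x ∷ u) (suc m) e = s≤s (nth-< u m e)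

  ∈⇒nth : ∀ {u : List C} {c} → c ∈ u → Σ ℕ λ m → nth u m ≡ just c
  ∈⇒nth (here refl) = 0 , refl
  ∈⇒nth (there c∈u) with ∈⇒nth c∈u
  ... | m , e = suc m , e

  nth-applyUpTo : ∀ (f : ℕ → C) n m → m < n → nth (applyUpTo f n) m ≡ just (f m)
  nth-applyUpTo f (suc n) zero    _        = refl
  nth-applyUpTo f (suc n) (suc m) (s≤s lt) = nth-applyUpTo (λ k → f (suc k)) n m lt

  record Prefix (u : List C) (g : ℕ → C) : Set where
    constructor prefix
    field entry : ∀ m → m < length u → nth u m ≡ just (g m)
  open Prefix public

  Prefix-nth : ∀ {u g} → Prefix u g → ∀ m {c} → nth u m ≡ just c → c ≡ g m
  Prefix-nth {u} p m e = just-injective (trans (sym e) (entry p m (nth-< u m e)))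

  Prefix-tail : ∀ {x u g} → Prefix (x ∷ u) g → Prefix u (λ n → g (suc n))
  Prefix-tail p = prefix (λ m lt → entry p (suc m) (s≤s lt))

  Prefix-++ˡ : ∀ (u v : List C) {g} → Prefix (u ++ v) g → Prefix u g
  Prefix-++ˡ []      v p = prefix (λ _ ())
  Prefix-++ˡ (x ∷ u) v p = prefix λ where
    zero    _        → entry p zero (s≤s z≤n)
    (suc m) (s≤s lt) → entry (Prefix-++ˡ u v (Prefix-tail p)) m lt

  Prefix-≗ : ∀ {u g h} → (∀ m → g m ≡ h m) → Prefix u g → Prefix u h
  Prefix-≗ g≗h p = prefix (λ m lt → trans (entry p m lt) (cong just (g≗h m)))

  Prefix-++ : ∀ (u v : List C) {g} → Prefix u g → Prefix v (λ m → g (length u + m)) →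
              Prefix (u ++ v) g
  Prefix-++ []      v p q = q
  Prefix-++ (x ∷ u) v p q = prefix λ where
    zero    _        → entry p zero (s≤s z≤n)
    (suc m) (s≤s lt) → entry (Prefix-++ u v (Prefix-tail p) q) m lt

  applyUpTo-prefix : ∀ (f : ℕ → C) n → Prefix (applyUpTo f n) f
  applyUpTo-prefix f n = prefix (λ m lt → nth-applyUpTo f n m (subst (m <_) (length-applyUpTo f n) lt))

  unique-same-length : ∀ {xs ys : List C} → Unique xs → Unique ys →
    (∀ {x} → x ∈ xs → x ∈ ys) → (∀ {x} → x ∈ ys → x ∈ xs) → length xs ≡ length ys
  unique-same-length ux uy to from =
    ↭-length (∼bag⇒↭ (unique∧set⇒bag ux uy (mk⇔ to from)))

-- Enumerations of a set, and bringing a finite tuple to the front of one.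

transpose : ℕ → ℕ → ℕ → ℕ
transpose a b n with n ≟ a
... | yes _ = b
... | no _ with n ≟ b
...   | yes _ = a
...   | no _  = n

transpose-left : ∀ a b → transpose a b a ≡ b
transpose-left a b with a ≟ a
... | yes _   = refl
... | no a≢a = contradiction refl a≢a

transpose-right : ∀ a b → transpose a b b ≡ a
transpose-right a b with b ≟ a
... | yes b≡a = b≡a
... | no _ with b ≟ b
...   | yes _   = refl
...   | no b≢b = contradiction refl b≢b

transpose-other : ∀ a b n → n ≢ a → n ≢ b → transpose a b n ≡ n
transpose-other a b n n≢a n≢b with n ≟ a
... | yes n≡a = contradiction n≡a n≢a
... | no _ with n ≟ b
...   | yes n≡b = contradiction n≡b n≢b
...   | no _    = refl

transpose-involutive : ∀ a b n → transpose a b (transpose a b n) ≡ n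
transpose-involutive a b n with n ≟ a
... | yes refl = transpose-right n b
... | no n≢a with n ≟ b
...   | yes refl = transpose-left a n
...   | no n≢b   = transpose-other a b n n≢a n≢b

record Enumeration (C : Set) : Set where
  field
    at    : ℕ → C
    isBij : IsBij at

  index : C → ℕ
  index = IsBij.inv isBij

  index-at : ∀ n → index (at n) ≡ n
  index-at = IsBij.inv-l isBij

  at-index : ∀ c → at (index c) ≡ c
  at-index = IsBij.inv-r isBij

  at-injective : ∀ {m n} → at m ≡ at n → m ≡ n
  at-injective {m} {n} e = trans (sym (index-at m)) (trans (cong index e) (index-at n))
open Enumeration public

swapPositions : ∀ {C} → Enumeration C → ℕ → ℕ → Enumeration C
swapPositions G a b = record
  { at    = λ n → at G (transpose a b n)
  ; isBij = record
    { inv   = λ c → transpose a b (index G c)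
    ; inv-l = λ n → trans (cong (transpose a b) (index-at G _)) (transpose-involutive a b n)
    ; inv-r = λ c → trans (cong (at G) (transpose-involutive a b _)) (at-index G c) } }

placeFrom : ∀ {C} → Enumeration C → ℕ → List C → Enumeration C
placeFrom G k []       = G
placeFrom G k (c ∷ cs) = placeFrom (swapPositions G k (index G c)) (suc k) cs

outside⇒≢start : ∀ {n k} m → n < k ⊎ k + suc m ≤ n → n ≢ k
outside⇒≢start m   (inj₁ n<n) refl = <-irrefl refl n<n
outside⇒≢start {n} m (inj₂ le)  refl =
  <-irrefl refl (<-≤-trans (s≤s (m≤m+n n m)) (subst (_≤ n) (+-suc n m) le))

placeFrom-outside : ∀ {C} (G : Enumeration C) k (u : List C) n →
  n < k ⊎ k + length u ≤ n → at G n ∉ u → at (placeFrom G k u) n ≡ at G n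
placeFrom-outside G k []       n outside n∉u = refl
placeFrom-outside G k (c ∷ cs) n outside n∉u =
  trans (placeFrom-outside G' (suc k) cs n outside' (subst (_∉ cs) (sym unmoved) (λ m → n∉u (there m))))
        unmoved
  where
    G' : Enumeration _
    G' = swapPositions G k (index G c)
    n≢k : n ≢ k
    n≢k = outside⇒≢start (length cs) outside
    unmoved : at G' n ≡ at G n
    unmoved = cong (at G) (transpose-other k (index G c) n n≢k
                (λ n≡ic → n∉u (here (trans (cong (at G) n≡ic) (at-index G c)))))
    outside' : n < suc k ⊎ suc k + length cs ≤ n
    outside' = Sum.map m<n⇒m<1+n (≤-trans (≤-reflexive (sym (+-suc k (length cs))))) outside

placeFrom-inside : ∀ {C} (G : Enumeration C) k (u : List C) → Unique u →
  ∀ m → m < length u → nth u m ≡ just (at (placeFrom G k u) (k + m))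
placeFrom-inside G k (c ∷ cs) (c≢cs ∷ _) zero _ = cong just (sym (begin
    at (placeFrom G' (suc k) cs) (k + 0) ≡⟨ cong (at (placeFrom G' (suc k) cs)) (+-identityʳ k) ⟩
    at (placeFrom G' (suc k) cs) k       ≡⟨ placeFrom-outside G' (suc k) cs k (inj₁ (n<1+n k)) placed∉cs ⟩
    at G' k                              ≡⟨ placed ⟩
    c                                    ∎))
  where
    open ≡-Reasoning
    G' : Enumeration _
    G' = swapPositions G k (index G c)
    placed : at G' k ≡ c
    placed = trans (cong (at G) (transpose-left k (index G c))) (at-index G c)
    placed∉cs : at G' k ∉ cs
    placed∉cs = subst (_∉ cs) (sym placed) (λ c∈cs → All.lookup c≢cs c∈cs refl)
placeFrom-inside G k (c ∷ cs) (_ ∷ ucs) (suc m) (s≤s lt) rewrite +-suc k m =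
  placeFrom-inside (swapPositions G k (index G c)) (suc k) cs ucs m lt

placeFrom-prefix : ∀ {C} (G : Enumeration C) (u : List C) → Unique u → Prefix u (at (placeFrom G 0 u))
placeFrom-prefix G u un = prefix (placeFrom-inside G 0 u un)

-- Pullback copies of a structure along enumerations, and the oracles Φ* runs on.

maxV : ∀ {n} → Vec ℕ n → ℕ
maxV []       = 0
maxV (x ∷ xs) = x ⊔ maxV xs

querySize : ∀ {L} → Q3 L → ℕ
querySize (inj₁ (j , xs))        = j ⊔ maxV xs
querySize (inj₂ (inj₁ (x , y)))  = x ⊔ y
querySize (inj₂ (inj₂ (j , xs))) = j ⊔ maxV xs

module Pullback {L : Sig} (S : CStructure L) where

  C : Set
  C = carrier S

  baseEnum : Enumeration C
  baseEnum = record { at = enum S ; isBij = enum-bij S }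

  copyAlong : Enumeration C → Copy S
  copyAlong G = (λ j xs → rel S j (Vec.map (at G) xs)) , at G , isBij G , λ j xs → refl

  transition : Enumeration C → Enumeration C → ℕ → ℕ
  transition G H n = index H (at G n)

  transition-iso : ∀ G H → IsIsoω (proj₁ (copyAlong G)) (proj₁ (copyAlong H)) (transition G H)
  transition-iso G H =
    record { inv   = transition H G
           ; inv-l = λ n → trans (cong (index G) (at-index H _)) (index-at G n)
           ; inv-r = λ n → trans (cong (index H) (at-index G _)) (index-at H n) } ,
    λ j xs → cong (rel S j) (trans (sym (Vec.map-∘ (at H) (transition G H) xs))
                                   (Vec.map-cong (λ n → at-index H (at G n)) xs))

  fullOracle : Enumeration C → Enumeration C → Oracle (Q3 L)
  fullOracle G H = total (D (proj₁ (copyAlong G))) ⊕₃ total (graph (transition G H))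
                     ⊕₃ total (D (proj₁ (copyAlong H)))

  tupleOracle : List C → List C → Oracle (Q3 L)
  tupleOracle U V = finDiag S U ⊕₃ permGraph S U V ⊕₃ finDiag S V

  identityOracle : List C → Oracle (Q3 L)
  identityOracle U = finDiag S U ⊕₃ idRestr (length U) ⊕₃ finDiag S U

  nths-sound : ∀ {U : List C} {g : ℕ → C} → Prefix U g → ∀ {n} (xs : Vec ℕ n) {ys} →
               nths U xs ≡ just ys → ys ≡ Vec.map g xs
  nths-sound p [] refl = refl
  nths-sound {U} p (x ∷ xs) e with nth U x in ex | nths U xs in exs
  ... | just c  | just cs with refl ← e = cong₂ _∷_ (Prefix-nth p x ex) (nths-sound p xs exs)
  ... | just _  | nothing with () ← e
  ... | nothing | _       with () ← e

  finDiag-sound : ∀ {U : List C} {g : ℕ → C} → Prefix U g → ∀ j xs {v} →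
                  finDiag S U (j , xs) ≡ just v → v ≡ rel S j (Vec.map g xs)
  finDiag-sound {U} p j xs e with j <ᵇ length U | nths U xs in exs
  ... | true  | just ys with refl ← e = cong (rel S j) (nths-sound p xs exs)
  ... | true  | nothing with () ← e
  ... | false | _       with () ← e

  nths-complete : ∀ {U : List C} {g : ℕ → C} → Prefix U g → ∀ {n} (xs : Vec ℕ n) →
                  maxV xs < length U → nths U xs ≡ just (Vec.map g xs)
  nths-complete p []       _  = refl
  nths-complete p (x ∷ xs) lt =
    cong₂ (Maybe.zipWith _∷_) (entry p x (m⊔n<o⇒m<o x (maxV xs) lt))
                              (nths-complete p xs (m⊔n<o⇒n<o x (maxV xs) lt))

  finDiag-complete : ∀ {U : List C} {g : ℕ → C} → Prefix U g → ∀ j xs → j ⊔ maxV xs < length U →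
                     finDiag S U (j , xs) ≡ just (rel S j (Vec.map g xs))
  finDiag-complete p j xs lt =
    cong₂ (λ b m → if b then Maybe.map (rel S j) m else nothing)
          (Equivalence.to T-≡ (<⇒<ᵇ (m⊔n<o⇒m<o j (maxV xs) lt)))
          (nths-complete p xs (m⊔n<o⇒n<o j (maxV xs) lt))

  transition-graph : ∀ G H x y → does (decEq S (at G x) (at H y)) ≡ graph (transition G H) (x , y)
  transition-graph G H x y = does-⇔ (mk⇔ to from) (decEq S (at G x) (at H y)) (transition G H x ≟ y)
    where
      to : at G x ≡ at H y → transition G H x ≡ y
      to e = trans (cong (index H) e) (index-at H y)
      from : transition G H x ≡ y → at G x ≡ at H y
      from e = trans (sym (at-index H _)) (cong (at H) e)

  permGraph-sound : ∀ {U V} G H → Prefix U (at G) → Prefix V (at H) → ∀ x y {v} →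
                    permGraph S U V (x , y) ≡ just v → v ≡ graph (transition G H) (x , y)
  permGraph-sound {U} {V} G H pG pH x y e with nth U x in ex | nth V y in ey
  ... | just a  | just a' with refl ← Prefix-nth pG x ex | refl ← Prefix-nth pH y ey =
    trans (sym (just-injective e)) (transition-graph G H x y)
  ... | just _  | nothing with () ← e
  ... | nothing | _       with () ← e

  permGraph-complete : ∀ {U V} G H → Prefix U (at G) → Prefix V (at H) → ∀ x y →
                       x < length U → y < length V →
                       permGraph S U V (x , y) ≡ just (graph (transition G H) (x , y))
  permGraph-complete G H pG pH x y x< y< rewrite entry pG x x< | entry pH y y< =
    cong just (transition-graph G H x y)

  tupleOracle-⊑ : ∀ {U V G H} → Prefix U (at G) → Prefix V (at H) → tupleOracle U V ⊑ fullOracle G H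
  tupleOracle-⊑ pG pH (inj₁ (j , xs))        v e = cong just (sym (finDiag-sound pG j xs e))
  tupleOracle-⊑ pG pH (inj₂ (inj₂ (j , xs))) v e = cong just (sym (finDiag-sound pH j xs e))
  tupleOracle-⊑ {G = G} {H} pG pH (inj₂ (inj₁ (x , y))) v e =
    cong just (sym (permGraph-sound G H pG pH x y e))

  tupleOracle-agrees : ∀ {U V G H} → Prefix U (at G) → Prefix V (at H) → ∀ q →
                       querySize q < length U → querySize q < length V →
                       tupleOracle U V q ≡ fullOracle G H q
  tupleOracle-agrees pG pH (inj₁ (j , xs))        ltU ltV = finDiag-complete pG j xs ltU
  tupleOracle-agrees pG pH (inj₂ (inj₂ (j , xs))) ltU ltV = finDiag-complete pH j xs ltV
  tupleOracle-agrees {G = G} {H} pG pH (inj₂ (inj₁ (x , y))) ltU ltV =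
    permGraph-complete G H pG pH x y (m⊔n<o⇒m<o x y ltU) (m⊔n<o⇒n<o x y ltV)

  transition-fixes : ∀ {U} G H → Prefix U (at G) → Prefix U (at H) → ∀ x → x < length U →
                     transition G H x ≡ x
  transition-fixes G H pG pH x lt =
    trans (cong (index H) (just-injective (trans (sym (entry pG x lt)) (entry pH x lt)))) (index-at H x)

  identityOracle-⊑ : ∀ {U G H} → Prefix U (at G) → Prefix U (at H) → identityOracle U ⊑ fullOracle G H
  identityOracle-⊑ pG pH (inj₁ (j , xs))        v e = cong just (sym (finDiag-sound pG j xs e))
  identityOracle-⊑ pG pH (inj₂ (inj₂ (j , xs))) v e = cong just (sym (finDiag-sound pH j xs e))
  identityOracle-⊑ {U} {G} {H} pG pH (inj₂ (inj₁ (x , y))) v e with x <ᵇ length U in x<U | y <ᵇ length U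
  ... | true  | true  =
    trans (cong (λ z → just (z ≡ᵇ y))
                (transition-fixes G H pG pH x (<ᵇ⇒< x (length U) (Equivalence.from T-≡ x<U)))) e
  ... | true  | false with () ← e
  ... | false | _     with () ← e

-- The functor, applied to the transition maps between pullback copies.

∘-iso : ∀ {L} {M N O : ωStr L} {f g} → IsIsoω M N f → IsIsoω N O g → IsIsoω M O (λ n → g (f n))
∘-iso {O = O} {f} {g} (bij-f , pres-f) (bij-g , pres-g) =
  record { inv   = λ n → IsBij.inv bij-f (IsBij.inv bij-g n)
         ; inv-l = λ n → trans (cong (IsBij.inv bij-f) (IsBij.inv-l bij-g (f n))) (IsBij.inv-l bij-f n)
         ; inv-r = λ n → trans (cong g (IsBij.inv-r bij-f _)) (IsBij.inv-r bij-g n) } ,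
  λ j xs → trans (cong (O j) (Vec.map-∘ g f xs)) (trans (pres-g j (Vec.map f xs)) (pres-f j xs))

id-iso : ∀ {L} (M : ωStr L) → IsIsoω M M (λ n → n)
id-iso M = record { inv = λ n → n ; inv-l = λ _ → refl ; inv-r = λ _ → refl } ,
           λ j xs → cong (M j) (Vec.map-id xs)

module FunctorOnEnumerations {LA LB : Sig} (A : CStructure LA) (B : CStructure LB)
         (Φ : Atom LA → Machine (Atom LB) Bool) (Φ* : ℕ → Machine (Q3 LB) ℕ)
         (F : Functor B A) (W : Witnesses B A Φ Φ* F) where
  open Pullback B
  open Witnesses W using (Φ*-ok)

  Fσ : Enumeration C → Enumeration C → ℕ → ℕ
  Fσ G H = mor F (copyAlong G) (copyAlong H) (transition G H) (transition-iso G H)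

  Fσ-computed : ∀ G H n → Φ* n ⟨ fullOracle G H ⟩⇓ Fσ G H n
  Fσ-computed G H = Φ*-ok (copyAlong G) (copyAlong H) (transition G H) (transition-iso G H)

  Fσ-from-sub-oracle : ∀ G H {α n m} → α ⊑ fullOracle G H → Φ* n ⟨ α ⟩⇓ m → Fσ G H n ≡ m
  Fσ-from-sub-oracle G H α⊑full run = ⇓-functional (Fσ-computed G H _) (⇓-extend run α⊑full)

  -- F(f) depends only on the values of f, since Φ* sees only the graph of f.
  mor-ext : ∀ X Y f f' p p' → (∀ n → f n ≡ f' n) → ∀ n → mor F X Y f p n ≡ mor F X Y f' p' n
  mor-ext X Y f f' p p' f≗f' n = ⇓-functional (Φ*-ok X Y f p n) (⇓-extend (Φ*-ok X Y f' p' n) same-graph)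
    where
      same-graph : (total (D (proj₁ X)) ⊕₃ total (graph f') ⊕₃ total (D (proj₁ Y))) ⊑
                   (total (D (proj₁ X)) ⊕₃ total (graph f) ⊕₃ total (D (proj₁ Y)))
      same-graph (inj₁ a)              v e = e
      same-graph (inj₂ (inj₁ (x , y))) v e rewrite f≗f' x = e
      same-graph (inj₂ (inj₂ a))       v e = e

  Fσ-compose : ∀ G H K n → Fσ G K n ≡ Fσ H K (Fσ G H n)
  Fσ-compose G H K n =
    trans (mor-ext (copyAlong G) (copyAlong K) (transition G K) (λ m → transition H K (transition G H m))
                   (transition-iso G K) G→K (λ m → cong (index K) (sym (at-index H _))) n)
          (mor-comp F (copyAlong G) (copyAlong H) (copyAlong K) (transition G H) (transition H K)
                    (transition-iso G H) (transition-iso H K) G→K n)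
    where
      G→K : IsIsoω (proj₁ (copyAlong G)) (proj₁ (copyAlong K)) (λ m → transition H K (transition G H m))
      G→K = ∘-iso {M = proj₁ (copyAlong G)} {proj₁ (copyAlong H)} {proj₁ (copyAlong K)}
                  (transition-iso G H) (transition-iso H K)

  Fσ-identity : ∀ G n → Fσ G G n ≡ n
  Fσ-identity G n =
    trans (mor-ext (copyAlong G) (copyAlong G) (transition G G) (λ m → m)
                   (transition-iso G G) (id-iso _) (index-at G) n)
          (mor-id F (copyAlong G) (id-iso _) n)

  Fσ-inverse : ∀ G H n → Fσ H G (Fσ G H n) ≡ n
  Fσ-inverse G H n = trans (sym (Fσ-compose G H G n)) (Fσ-identity G n)

  Fσ-fixes-Dom : ∀ {u i} → InDom B Φ* (u , i) → ∀ G H → Prefix u (at G) → Prefix u (at H) →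
                 Fσ G H i ≡ i
  Fσ-fixes-Dom (_ , run) G H pG pH = Fσ-from-sub-oracle G H (identityOracle-⊑ {G = G} {H} pG pH) run

  FiniteRun : Enumeration C → Enumeration C → ℕ → ℕ → ℕ → Set
  FiniteRun G H n m N = ∀ {U V} → Prefix U (at G) → Prefix V (at H) →
                        N < length U → N < length V → Φ* n ⟨ tupleOracle U V ⟩⇓ m

  Fσ-finite-use : ∀ G H {i k} → Fσ G H i ≡ k → Σ ℕ (FiniteRun G H i k)
  Fσ-finite-use G H {i} refl with ⇓-use querySize (Fσ-computed G H i)
  ... | N , use = N , λ pG pH N<U N<V → use _ (λ q q≤N →
        tupleOracle-agrees {G = G} {H} pG pH q (≤-<-trans q≤N N<U) (≤-<-trans q≤N N<V))

module Tuples {L : Sig} (S : CStructure L) where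
  open import Data.List.Membership.DecPropositional (decEq S) using (_∈?_)

  minus-∈⁻ : ∀ {x} (c b : List (carrier S)) → x ∈ minus S c b → x ∈ c × x ∉ b
  minus-∈⁻ c b = ∈-filter⁻ (λ x → ¬? (x ∈? b))

  minus-∈⁺ : ∀ {x} (c b : List (carrier S)) → x ∈ c → x ∉ b → x ∈ minus S c b
  minus-∈⁺ c b = ∈-filter⁺ (λ x → ¬? (x ∈? b))

  union : List (carrier S) → List (carrier S) → List (carrier S)
  union b c = b ++ minus S c b

  ∈-union⁺ : ∀ {x} (b c : List (carrier S)) → x ∈ b ⊎ x ∈ c → x ∈ union b c
  ∈-union⁺ b c (inj₁ x∈b) = ∈-++⁺ˡ x∈b
  ∈-union⁺ {x} b c (inj₂ x∈c) with x ∈? b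
  ... | yes x∈b = ∈-++⁺ˡ x∈b
  ... | no  x∉b = ∈-++⁺ʳ b (minus-∈⁺ c b x∈c x∉b)

  ∈-union⁻ : ∀ {x} (b c : List (carrier S)) → x ∈ union b c → x ∈ b ⊎ x ∈ c
  ∈-union⁻ b c x∈bc = Sum.map₂ (λ x∈c' → proj₁ (minus-∈⁻ c b x∈c')) (∈-++⁻ b x∈bc)

  ∈-union-comm : ∀ {x} (b c : List (carrier S)) → x ∈ union b c → x ∈ union c b
  ∈-union-comm b c x∈bc = ∈-union⁺ c b (Sum.swap (∈-union⁻ b c x∈bc))

  union-unique : ∀ {b c} → Unique b → Unique c → Unique (union b c)
  union-unique {b} {c} ub uc =
    Unique.++⁺ ub (Unique.filter⁺ (λ x → ¬? (x ∈? b)) uc)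
               (λ (x∈b , x∈c') → proj₂ (minus-∈⁻ c b x∈c') x∈b)

  union-length-comm : ∀ {b c} → Unique b → Unique c → length (union b c) ≡ length (union c b)
  union-length-comm {b} {c} ub uc =
    unique-same-length (union-unique ub uc) (union-unique uc ub) (∈-union-comm b c) (∈-union-comm c b)

  padded-unique : ∀ {b c d} → Unique b → Unique c → Unique d → All (λ x → x ∉ b × x ∉ c) d →
                  Unique (b ++ minus S c b ++ d)
  padded-unique {b} {c} {d} ub uc ud d-fresh =
    subst Unique (++-assoc b (minus S c b) d) (Unique.++⁺ (union-unique ub uc) ud disjoint)
    where
      disjoint : ∀ {x} → ¬ (x ∈ union b c × x ∈ d)
      disjoint (x∈bc , x∈d) with ∈-union⁻ b c x∈bc
      ... | inj₁ x∈b = proj₁ (All.lookup d-fresh x∈d) x∈b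
      ... | inj₂ x∈c = proj₂ (All.lookup d-fresh x∈d) x∈c

-- Two enumerations, beginning with b̄ ē' and with ē b̄' respectively, that agree
-- from position |b̄ ē'| on.  Any initial part of their common tail can serve as
-- the tuple d̄ of the definition of ∼.

module CommonTail {L : Sig} (S : CStructure L) {b e : List (carrier S)} (ub : Unique b) (ue : Unique e) where
  open Pullback S
  open Tuples S

  P Q : List C
  P = union b e
  Q = union e b

  |Q|≡|P| : length Q ≡ length P
  |Q|≡|P| = union-length-comm ue ub

  Gb Ge : Enumeration C
  Gb = placeFrom baseEnum 0 P
  Ge = placeFrom Gb 0 Q

  Gb-prefix : Prefix P (at Gb)
  Gb-prefix = placeFrom-prefix baseEnum P (union-unique ub ue)

  Ge-prefix : Prefix Q (at Ge)
  Ge-prefix = placeFrom-prefix Gb Q (union-unique ue ub)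

  Gb-beyond : ∀ n → length P ≤ n → at Gb n ∉ P
  Gb-beyond n P≤n Gbn∈P with ∈⇒nth Gbn∈P
  ... | m , e = <-irrefl refl (<-≤-trans (nth-< P m e)
                  (≤-trans P≤n (≤-reflexive (at-injective Gb (Prefix-nth Gb-prefix m e)))))

  -- Moving Q to the front of Gb leaves those positions alone, as Q lists the same elements as P.
  common-tail : ∀ m → at Gb (length P + m) ≡ at Ge (length Q + m)
  common-tail m = begin
    at Gb (length P + m) ≡⟨ placeFrom-outside Gb 0 Q (length P + m) (inj₂ Q≤) ∉Q ⟨
    at Ge (length P + m) ≡⟨ cong (λ l → at Ge (l + m)) |Q|≡|P| ⟨
    at Ge (length Q + m) ∎
    where
      open ≡-Reasoning
      Q≤ : length Q ≤ length P + m
      Q≤ = ≤-trans (≤-reflexive |Q|≡|P|) (m≤m+n (length P) m)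
      ∉Q : at Gb (length P + m) ∉ Q
      ∉Q x∈Q = Gb-beyond (length P + m) (m≤m+n (length P) m) (∈-union-comm e b x∈Q)

  padding : ℕ → List C
  padding n = applyUpTo (λ m → at Gb (length P + m)) n

  padding-unique : ∀ n → Unique (padding n)
  padding-unique n = Unique.applyUpTo⁺₁ _ n
    (λ i<j _ eq → <⇒≢ i<j (+-cancelˡ-≡ (length P) _ _ (at-injective Gb eq)))

  padding-fresh : ∀ n → All (λ d → d ∉ b × d ∉ e) (padding n)
  padding-fresh n = All.tabulate λ d∈ → case-padding (∈-applyUpTo⁻ (λ m → at Gb (length P + m)) d∈)
    where
      case-padding : ∀ {d} → Σ ℕ (λ i → i < n × d ≡ at Gb (length P + i)) → d ∉ b × d ∉ e
      case-padding (i , _ , refl) =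
        (λ d∈b → Gb-beyond _ (m≤m+n (length P) i) (∈-union⁺ b e (inj₁ d∈b))) ,
        (λ d∈e → Gb-beyond _ (m≤m+n (length P) i) (∈-union⁺ b e (inj₂ d∈e)))

  padded-prefixˡ : ∀ n → Prefix (b ++ minus S e b ++ padding n) (at Gb)
  padded-prefixˡ n = subst (λ u → Prefix u (at Gb)) (++-assoc b (minus S e b) (padding n))
    (Prefix-++ P (padding n) Gb-prefix (applyUpTo-prefix _ n))

  padded-prefixʳ : ∀ n → Prefix (e ++ minus S b e ++ padding n) (at Ge)
  padded-prefixʳ n = subst (λ u → Prefix u (at Ge)) (++-assoc e (minus S b e) (padding n))
    (Prefix-++ Q (padding n) Ge-prefix (Prefix-≗ common-tail (applyUpTo-prefix _ n)))

  padded-long : ∀ (x y : List C) {m n} → m < n → m < length (x ++ y ++ padding n)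
  padded-long x y {m} {n} m<n = <-≤-trans m<n (begin
    n                                  ≡⟨ length-applyUpTo _ n ⟨
    length (padding n)                 ≤⟨ m≤n+m _ (length y) ⟩
    length y + length (padding n)      ≡⟨ length-++ y ⟨
    length (y ++ padding n)            ≤⟨ m≤n+m _ (length x) ⟩
    length x + length (y ++ padding n) ≡⟨ length-++ x ⟨
    length (x ++ y ++ padding n)       ∎)
    where open ≤-Reasoning

-- ∼ coincides with the relation ⊳ read off the functor.

module Similarity {LA LB : Sig} (A : CStructure LA) (B : CStructure LB)
         (Φ : Atom LA → Machine (Atom LB) Bool) (Φ* : ℕ → Machine (Q3 LB) ℕ)
         (F : Functor B A) (W : Witnesses B A Φ Φ* F) where
  open Pullback B
  open Tuples B
  open FunctorOnEnumerations A B Φ Φ* F W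

  _⊳_ : Dom B Φ* → Dom B Φ* → Set
  ((b , i) , _) ⊳ ((c , j) , _) = ∀ G H → Prefix b (at G) → Prefix c (at H) → Fσ G H i ≡ j

  -- Reflexivity is exactly the defining property of Dom.
  ⊳-refl : ∀ x → x ⊳ x
  ⊳-refl (_ , dom) = Fσ-fixes-Dom dom

  -- Factor through any enumeration H beginning with the middle tuple.
  ⊳-trans : ∀ {x y z} → x ⊳ y → y ⊳ z → x ⊳ z
  ⊳-trans {(b , i) , _} {(c , j) , (uc , _)} {(e , k) , _} x⊳y y⊳z G K pG pK = begin
    Fσ G K i           ≡⟨ Fσ-compose G H K i ⟩
    Fσ H K (Fσ G H i)  ≡⟨ cong (Fσ H K) (x⊳y G H pG pH) ⟩
    Fσ H K j           ≡⟨ y⊳z H K pH pK ⟩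
    k                  ∎
    where
      open ≡-Reasoning
      H : Enumeration C
      H = placeFrom baseEnum 0 c
      pH : Prefix c (at H)
      pH = placeFrom-prefix baseEnum c uc

  -- A witness d̄ of (b̄ , i) ∼ (c̄ , j) yields enumerations G₁, G₂ beginning with
  -- b̄ c̄' d̄ and c̄ b̄' d̄ with Fσ G₁ G₂ i = j; the rest is functoriality.
  ∼⇒⊳ : ∀ {x y} → Sim B Φ* x y → x ⊳ y
  ∼⇒⊳ {(b , i) , (ub , db)} {(c , j) , (uc , dc)} (d , ud , d-fresh , run , _) G H pG pH = begin
    Fσ G H i              ≡⟨ Fσ-compose G G₁ H i ⟩
    Fσ G₁ H (Fσ G G₁ i)   ≡⟨ cong (Fσ G₁ H) (Fσ-fixes-Dom (ub , db) G G₁ pG (Prefix-++ˡ b _ p₁)) ⟩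
    Fσ G₁ H i             ≡⟨ Fσ-compose G₁ G₂ H i ⟩
    Fσ G₂ H (Fσ G₁ G₂ i)  ≡⟨ cong (Fσ G₂ H) G₁→G₂ ⟩
    Fσ G₂ H j             ≡⟨ Fσ-fixes-Dom (uc , dc) G₂ H (Prefix-++ˡ c _ p₂) pH ⟩
    j                     ∎
    where
      open ≡-Reasoning
      U V : List C
      U = b ++ minus B c b ++ d
      V = c ++ minus B b c ++ d
      G₁ G₂ : Enumeration C
      G₁ = placeFrom baseEnum 0 U
      G₂ = placeFrom baseEnum 0 V
      p₁ : Prefix U (at G₁)
      p₁ = placeFrom-prefix baseEnum U (padded-unique ub uc ud d-fresh)
      p₂ : Prefix V (at G₂)
      p₂ = placeFrom-prefix baseEnum V (padded-unique uc ub ud (All.map swap d-fresh))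
      G₁→G₂ : Fσ G₁ G₂ i ≡ j
      G₁→G₂ = Fσ-from-sub-oracle G₁ G₂ (tupleOracle-⊑ {G = G₁} {G₂} p₁ p₂) run

  -- Conversely, run Φ* in both directions on the canonical pair Gb, Ge and pad
  -- with their common tail beyond both use bounds.
  ⊳⇒∼ : ∀ {x y} → x ⊳ y → Sim B Φ* x y
  ⊳⇒∼ {(b , i) , (ub , _)} {(e , k) , (ue , _)} x⊳y =
    padding n , padding-unique n , padding-fresh n ,
    proj₂ use-fwd (padded-prefixˡ n) (padded-prefixʳ n)
                  (padded-long b _ (s≤s (m≤m+n N₁ N₂))) (padded-long e _ (s≤s (m≤m+n N₁ N₂))) ,
    proj₂ use-bwd (padded-prefixʳ n) (padded-prefixˡ n)
                  (padded-long e _ (s≤s (m≤n+m N₂ N₁))) (padded-long b _ (s≤s (m≤n+m N₂ N₁)))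
    where
      open CommonTail B ub ue
      fwd : Fσ Gb Ge i ≡ k
      fwd = x⊳y Gb Ge (Prefix-++ˡ b _ Gb-prefix) (Prefix-++ˡ e _ Ge-prefix)
      bwd : Fσ Ge Gb k ≡ i
      bwd = trans (cong (Fσ Ge Gb) (sym fwd)) (Fσ-inverse Gb Ge i)
      use-fwd : Σ ℕ (FiniteRun Gb Ge i k)
      use-fwd = Fσ-finite-use Gb Ge fwd
      use-bwd : Σ ℕ (FiniteRun Ge Gb k i)
      use-bwd = Fσ-finite-use Ge Gb bwd
      N₁ N₂ n : ℕ
      N₁ = proj₁ use-fwd
      N₂ = proj₁ use-bwd
      n = suc (N₁ + N₂)

-- ∼ is reflexive and transitive because ⊳ is, and symmetric by definition.
lemma2p5 : {LA LB : Sig} (A : CStructure LA) (B : CStructure LB)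
           (Φ : Atom LA → Machine (Atom LB) Bool) (Φ* : ℕ → Machine (Q3 LB) ℕ)
           (F : Functor B A) → Witnesses B A Φ Φ* F →
           IsEquivalence (Sim B Φ*)
lemma2p5 A B Φ Φ* F W = record
  { refl  = λ {x} → ⊳⇒∼ {x} {x} (⊳-refl x)
  ; sym   = λ { (d , ud , d-fresh , run , run′) → d , ud , All.map swap d-fresh , run′ , run }
  ; trans = λ {x} {y} {z} x∼y y∼z →
              ⊳⇒∼ {x} {z} (⊳-trans {x} {y} {z} (∼⇒⊳ {x} {y} x∼y) (∼⇒⊳ {y} {z} y∼z))
  }
  where open Similarity A B Φ Φ* F W
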